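{- Let $p$ be an odd prime. For every integer $n\ge1$, $$\int_{\mathbb{Z}_p}(x+1)_{(n)}\,d\mu_{ -1}(x)=(-1)^{n+1}\frac{n!}{2^n}.$$
   Context: For a polynomial function $f:\mathbb{Z}_p\to\mathbb{Q}_p$, the $p$-adic fermionic integral is $\int_{\mathbb{Z}_p}f(x)\,d\mu_{ -1}(x)=\lim_{N\to\infty}\sum_{x=0}^{p^N-1}(-1)^xf(x)$ (limit in the $p$-adic topology). The falling factorial is $x_{(n)}=x(x-1)\cdots(x-n+1)$, $x_{(0)}=1$. -}

module Defs where

open import Data.Nat as ℕ using (ℕ; zero; suc; _≤_; _^_)
open import Data.Nat using (_!)
open import Data.Nat.Divisibility using (_∣_)
open import Data.Integer as ℤ using (ℤ; +_; ∣_∣)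
open import Data.Rational using (ℚ; ↥_; ↧ₙ_; 0ℚ; 1ℚ; _+_; _*_; _-_; -_; _/_)
open import Data.Product using (Σ; _×_)
open import Relation.Nullary using (¬_)

fallFact : ℤ → ℕ → ℤ
fallFact x zero    = + 1
fallFact x (suc n) = x ℤ.* fallFact (x ℤ.- + 1) n

negOnePow : ℕ → ℚ
negOnePow zero    = 1ℚ
negOnePow (suc k) = - negOnePow k

sumBelow : ℕ → (ℕ → ℚ) → ℚ
sumBelow zero    g = 0ℚ
sumBelow (suc m) g = sumBelow m g + g m

-- Riemann-type partial sums of the fermionic integral: Σ_{x=0}^{p^N-1} (-1)^x f(x)
fermionicSum : ℕ → (ℕ → ℚ) → ℕ → ℚ
fermionicSum p f N = sumBelow (p ^ N) (λ x → negOnePow x * f x)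

-- v_p(q) ≥ k   (q written in lowest terms: p^k divides numerator, p does not divide denominator)
ValAtLeast : ℕ → ℕ → ℚ → Set
ValAtLeast p k q = (p ^ k ∣ ∣ ↥ q ∣) × ¬ (p ∣ ↧ₙ q)

PAdicLimit : ℕ → (ℕ → ℚ) → ℚ → Set
PAdicLimit p s r = (k : ℕ) → Σ ℕ (λ M → (N : ℕ) → M ≤ N → ValAtLeast p k (s N - r))

-- ∫_{ℤ_p} f dμ_{-1} = r, for f given by its values on ℕ (dense in ℤ_p; enough for polynomial f)
FermionicIntegral : ℕ → (ℕ → ℚ) → ℚ → Set
FermionicIntegral p f r = PAdicLimit p (fermionicSum p f) r

invPow2 : ℕ → ℚ
invPow2 zero    = 1ℚ
invPow2 (suc n) = (+ 1 / 2) * invPow2 n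

rhs : ℕ → ℚ
rhs n = negOnePow (suc n) * ((+ (n !) / 1) * invPow2 n)

integrand : ℕ → ℕ → ℚ
integrand n x = fallFact (+ (suc x)) n / 1

-- The operator g ↦ g(y) + g(y+1) is inverted on falling factorials, up to a power of 2, by
-- E₀ = 1, E_{n+1}(y) = 2^{n+1} (y+1)_(n+1) − (n+1) E_n(y): since Δ(y+1)_(n+1) = (n+1)(y+1)_(n),
-- induction gives E_n(y) + E_n(y+1) = 2^{n+1} (y+1)_(n). Hence for odd m the alternating sum
-- Σ_{x<m} (−1)^x (x+1)_(n) telescopes to (E_n(0) + E_n(m)) / 2^{n+1}, and E_n(0) = (−1)^{n−1} n!.
-- As E_n has integer coefficients, m divides E_n(m) − E_n(0); so at m = p^N the partial sum
-- differs from E_n(0)/2^n = (−1)^{n+1} n!/2^n by p^N times an integer over 2^{n+1}, whose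
-- p-adic valuation is at least N because p is odd.

{-# OPTIONS --safe #-}
module Submission where

open import Defs
open import Data.Nat as ℕ using (ℕ; zero; suc; _!; _≤_; _<_; z≤n; s≤s)
import Data.Nat.Properties as ℕ
import Data.Nat.Divisibility as ℕ
open import Data.Integer
  using (ℤ; ∣_∣; +_; +[1+_]; -[1+_]; 1ℤ; -1ℤ; _+_; _*_; _-_; -_; _^_)
import Data.Integer.Properties as ℤ
open import Data.Integer.Divisibility.Signed
  using (_∣_; divides; ∣m∣n⇒∣m+n; ∣m∣n⇒∣m-n; ∣n⇒∣m*n; ∣m⇒∣m*n; ∣-refl; ∣⇒∣ᵤ)
open import Data.Integer.Tactic.RingSolver using (solve-∀)
open import Data.Integer.GCD using (gcd)
open import Data.Rational as ℚ using (ℚ; mkℚ; ↥_; ↧_; ↧ₙ_; 1ℚ)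
import Data.Rational.Properties as ℚ
open import Data.Rational.Solver using (module +-*-Solver)
import Data.Nat.Coprimality as Coprimality
open Coprimality using (Coprime; coprime-divisor; prime⇒coprime)
open import Data.Nat.Primality using (Prime; prime⇒nonTrivial)
open import Function using (_∘_)
open import Data.Product using (_,_)
open import Data.Empty using (⊥-elim)
open import Relation.Nullary using (¬_)
open import Relation.Binary.PropositionalEquality
open ≡-Reasoning

coprime-*ʳ : ∀ {m n k} → Coprime m n → Coprime m k → Coprime m (n ℕ.* k)
coprime-*ʳ m⊥n m⊥k (d∣m , d∣nk) =
  m⊥k (d∣m , coprime-divisor (λ (e∣d , e∣n) → m⊥n (ℕ.∣-trans e∣d d∣m , e∣n)) d∣nk)

coprime-^ʳ : ∀ {m n} → Coprime m n → ∀ e → Coprime m (n ℕ.^ e)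
coprime-^ʳ m⊥n zero    (_ , d∣1) = ℕ.∣1⇒≡1 d∣1
coprime-^ʳ m⊥n (suc e) = coprime-*ʳ m⊥n (coprime-^ʳ m⊥n e)

coprime-^ : ∀ {m n} → Coprime m n → ∀ a b → Coprime (m ℕ.^ a) (n ℕ.^ b)
coprime-^ m⊥n a b = coprime-^ʳ (Coprimality.sym (coprime-^ʳ (Coprimality.sym m⊥n) a)) b

^-monoʳ-∣ : ∀ p {k N} → k ≤ N → p ℕ.^ k ℕ.∣ p ℕ.^ N
^-monoʳ-∣ p {N = N} z≤n   = ℕ.1∣ (p ℕ.^ N)
^-monoʳ-∣ p        (s≤s k≤N) = ℕ.*-monoʳ-∣ p (^-monoʳ-∣ p k≤N)

fallFact-sucʳ : ∀ y n → fallFact y (suc n) ≡ fallFact y n * (y - + n)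
fallFact-sucʳ y zero    = unit y
  where
  unit : ∀ a → a * 1ℤ ≡ 1ℤ * (a - + 0)
  unit = solve-∀
fallFact-sucʳ y (suc n) = begin
  y * fallFact (y - 1ℤ) (suc n)                 ≡⟨ cong (y *_) (fallFact-sucʳ (y - 1ℤ) n) ⟩
  y * (fallFact (y - 1ℤ) n * ((y - 1ℤ) - + n))  ≡⟨ reassoc y (fallFact (y - 1ℤ) n) (+ n) ⟩
  y * fallFact (y - 1ℤ) n * (y - (1ℤ + + n))    ∎
  where
  reassoc : ∀ a b c → a * (b * ((a - 1ℤ) - c)) ≡ a * b * (a - (1ℤ + c))
  reassoc = solve-∀

fallFact-forwardDiff : ∀ y n → fallFact (1ℤ + y) (suc n) - fallFact y (suc n) ≡ + suc n * fallFact y n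
fallFact-forwardDiff y n = begin
  (1ℤ + y) * fallFact ((1ℤ + y) - 1ℤ) n - fallFact y (suc n)
    ≡⟨ cong₂ (λ u v → (1ℤ + y) * fallFact u n - v) (cancel y) (fallFact-sucʳ y n) ⟩
  (1ℤ + y) * fallFact y n - fallFact y n * (y - + n)
    ≡⟨ collect y (fallFact y n) (+ n) ⟩
  (1ℤ + + n) * fallFact y n ∎
  where
  cancel : ∀ a → (1ℤ + a) - 1ℤ ≡ a
  cancel = solve-∀
  collect : ∀ a f c → (1ℤ + a) * f - f * (a - c) ≡ (1ℤ + c) * f
  collect = solve-∀

fallFact-sub-∣ : ∀ n y z → y - z ∣ fallFact y n - fallFact z n
fallFact-sub-∣ zero    y z = divides (+ 0) (sym (ℤ.*-zeroˡ (y - z)))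
fallFact-sub-∣ (suc n) y z =
  subst (y - z ∣_) (sym (split y z Fy Fz)) (∣m∣n⇒∣m+n (∣n⇒∣m*n y ih) (∣m⇒∣m*n Fz ∣-refl))
  where
  Fy = fallFact (y - 1ℤ) n
  Fz = fallFact (z - 1ℤ) n
  split : ∀ a b f g → a * f - b * g ≡ a * (f - g) + (a - b) * g
  split = solve-∀
  shift : ∀ a b → (a - 1ℤ) - (b - 1ℤ) ≡ a - b
  shift = solve-∀
  ih : y - z ∣ Fy - Fz
  ih = subst (_∣ Fy - Fz) (shift y z) (fallFact-sub-∣ n (y - 1ℤ) (z - 1ℤ))

altSum : (ℕ → ℤ) → ℕ → ℤ
altSum f zero    = + 0
altSum f (suc m) = altSum f m + -1ℤ ^ m * f m

altSum-telescope : ∀ (f g : ℕ → ℤ) c → (∀ x → g x + g (suc x) ≡ c * f x) →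
                   ∀ m → c * altSum f m ≡ g 0 - -1ℤ ^ m * g m
altSum-telescope f g c g+g≡cf zero    = base c (g 0)
  where
  base : ∀ a b → a * + 0 ≡ b - 1ℤ * b
  base = solve-∀
altSum-telescope f g c g+g≡cf (suc m) = begin
  c * (altSum f m + s * f m)               ≡⟨ distrib c (altSum f m) s (f m) ⟩
  c * altSum f m + s * (c * f m)
    ≡⟨ cong₂ (λ u v → u + s * v) (altSum-telescope f g c g+g≡cf m) (sym (g+g≡cf m)) ⟩
  (g 0 - s * g m) + s * (g m + g (suc m))  ≡⟨ cancel (g 0) s (g m) (g (suc m)) ⟩
  g 0 - -1ℤ * s * g (suc m)                ∎
  where
  s = -1ℤ ^ m
  distrib : ∀ a b u v → a * (b + u * v) ≡ a * b + u * (a * v)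
  distrib = solve-∀
  cancel : ∀ a u v w → (a - u * v) + u * (v + w) ≡ a - -1ℤ * u * w
  cancel = solve-∀

-1^-suc-suc : ∀ m → -1ℤ ^ suc (suc m) ≡ -1ℤ ^ m
-1^-suc-suc m = square (-1ℤ ^ m)
  where
  square : ∀ a → -1ℤ * (-1ℤ * a) ≡ a
  square = solve-∀

-1^odd : ∀ m → ¬ 2 ℕ.∣ m → -1ℤ ^ m ≡ -1ℤ
-1^odd zero          2∤m = ⊥-elim (2∤m (ℕ.divides 0 refl))
-1^odd (suc zero)    2∤m = refl
-1^odd (suc (suc m)) 2∤m =
  trans (-1^-suc-suc m) (-1^odd m (λ 2∣m → 2∤m (ℕ.∣m∣n⇒∣m+n ℕ.∣-refl 2∣m)))

eulerFalling : ℕ → ℤ → ℤ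
eulerFalling zero    y = 1ℤ
eulerFalling (suc n) y = + (2 ℕ.^ suc n) * fallFact (1ℤ + y) (suc n) - + suc n * eulerFalling n y

eulerFalling-+-shift : ∀ n y →
  eulerFalling n y + eulerFalling n (1ℤ + y) ≡ + (2 ℕ.^ suc n) * fallFact (1ℤ + y) n
eulerFalling-+-shift zero    y = refl
eulerFalling-+-shift (suc n) y = begin
  (c * A₀ - k * eulerFalling n y) + (c * A₁ - k * eulerFalling n (1ℤ + y))
    ≡⟨ regroup c k A₀ A₁ (eulerFalling n y) (eulerFalling n (1ℤ + y)) ⟩
  + 2 * c * A₀ + c * (A₁ - A₀) - k * (eulerFalling n y + eulerFalling n (1ℤ + y))
    ≡⟨ cong₂ (λ u v → + 2 * c * A₀ + c * u - k * v)
             (fallFact-forwardDiff (1ℤ + y) n) (eulerFalling-+-shift n y) ⟩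
  + 2 * c * A₀ + c * (k * B) - k * (c * B)
    ≡⟨ cancel c k A₀ B ⟩
  (+ 2 * c) * A₀
    ≡⟨ cong (_* A₀) (sym (ℤ.pos-* 2 (2 ℕ.^ suc n))) ⟩
  + (2 ℕ.^ suc (suc n)) * A₀ ∎
  where
  c = + (2 ℕ.^ suc n)
  k = + suc n
  A₀ = fallFact (1ℤ + y) (suc n)
  A₁ = fallFact (1ℤ + (1ℤ + y)) (suc n)
  B = fallFact (1ℤ + y) n
  regroup : ∀ c k a₀ a₁ e₀ e₁ →
            (c * a₀ - k * e₀) + (c * a₁ - k * e₁) ≡ + 2 * c * a₀ + c * (a₁ - a₀) - k * (e₀ + e₁)
  regroup = solve-∀
  cancel : ∀ c k a b → + 2 * c * a + c * (k * b) - k * (c * b) ≡ (+ 2 * c) * a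
  cancel = solve-∀

eulerFalling-zero : ∀ n → eulerFalling (suc n) (+ 0) ≡ -1ℤ ^ n * + (suc n !)
eulerFalling-zero zero    = refl
eulerFalling-zero (suc n) = begin
  c * + 0 - k * eulerFalling (suc n) (+ 0)
    ≡⟨ cong (λ u → c * + 0 - k * u) (eulerFalling-zero n) ⟩
  c * + 0 - k * (-1ℤ ^ n * f)
    ≡⟨ negate c k (-1ℤ ^ n) f ⟩
  -1ℤ * -1ℤ ^ n * (k * f)
    ≡⟨ cong (-1ℤ * -1ℤ ^ n *_) (sym (ℤ.pos-* (suc (suc n)) (suc n !))) ⟩
  -1ℤ ^ suc n * + (suc (suc n) !) ∎
  where
  c = + (2 ℕ.^ suc (suc n))
  k = + suc (suc n)
  f = + (suc n !)
  negate : ∀ c k s f → c * + 0 - k * (s * f) ≡ -1ℤ * s * (k * f)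
  negate = solve-∀

eulerFalling-sub-∣ : ∀ n y z → y - z ∣ eulerFalling n y - eulerFalling n z
eulerFalling-sub-∣ zero    y z = divides (+ 0) (sym (ℤ.*-zeroˡ (y - z)))
eulerFalling-sub-∣ (suc n) y z =
  subst (y - z ∣_) (sym (regroup c k Ay Az (eulerFalling n y) (eulerFalling n z)))
    (∣m∣n⇒∣m-n (∣n⇒∣m*n c A∣) (∣n⇒∣m*n k (eulerFalling-sub-∣ n y z)))
  where
  c = + (2 ℕ.^ suc n)
  k = + suc n
  Ay = fallFact (1ℤ + y) (suc n)
  Az = fallFact (1ℤ + z) (suc n)
  regroup : ∀ c k a b e f → (c * a - k * e) - (c * b - k * f) ≡ c * (a - b) - k * (e - f)
  regroup = solve-∀
  shift : ∀ a b → (1ℤ + a) - (1ℤ + b) ≡ a - b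
  shift = solve-∀
  A∣ : y - z ∣ Ay - Az
  A∣ = subst (_∣ Ay - Az) (shift y z) (fallFact-sub-∣ (suc n) (1ℤ + y) (1ℤ + z))

eulerFalling-congruence : ∀ n m → m ℕ.∣ ∣ eulerFalling n (+ m) - eulerFalling n (+ 0) ∣
eulerFalling-congruence n m =
  subst (ℕ._∣ ∣ eulerFalling n (+ m) - eulerFalling n (+ 0) ∣) (ℕ.+-identityʳ m)
    (∣⇒∣ᵤ (eulerFalling-sub-∣ n (+ m) (+ 0)))

altSum-eulerFalling : ∀ n m → ¬ 2 ℕ.∣ m →
  + (2 ℕ.^ suc n) * altSum (λ x → fallFact (+ suc x) n) m ≡ eulerFalling n (+ 0) + eulerFalling n (+ m)
altSum-eulerFalling n m 2∤m = begin
  + (2 ℕ.^ suc n) * altSum (λ x → fallFact (+ suc x) n) m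
    ≡⟨ altSum-telescope _ E (+ (2 ℕ.^ suc n)) (λ x → eulerFalling-+-shift n (+ x)) m ⟩
  E 0 - -1ℤ ^ m * E m   ≡⟨ cong (λ s → E 0 - s * E m) (-1^odd m 2∤m) ⟩
  E 0 - -1ℤ * E m       ≡⟨ flip (E 0) (E m) ⟩
  E 0 + E m             ∎
  where
  E : ℕ → ℤ
  E x = eulerFalling n (+ x)
  flip : ∀ a b → a - -1ℤ * b ≡ a + b
  flip = solve-∀

-- Unlike a / 1, this is already in normal form, so its numerator and denominator compute.
fromℤ : ℤ → ℚ
fromℤ a = mkℚ a 0 λ (_ , d∣1) → ℕ.∣1⇒≡1 d∣1

/1≡fromℤ : ∀ a → a ℚ./ 1 ≡ fromℤ a
/1≡fromℤ a = ℚ.↥p/↧p≡p (fromℤ a)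

fromℤ-homo-+ : ∀ a b → fromℤ (a + b) ≡ fromℤ a ℚ.+ fromℤ b
fromℤ-homo-+ a b = sym (trans
  (cong₂ (λ u v → (u + v) ℚ./ 1) (ℤ.*-identityʳ a) (ℤ.*-identityʳ b))
  (/1≡fromℤ (a + b)))

fromℤ-homo-* : ∀ a b → fromℤ (a * b) ≡ fromℤ a ℚ.* fromℤ b
fromℤ-homo-* a b = sym (/1≡fromℤ (a * b))

fromℤ-homo‿- : ∀ a → fromℤ (- a) ≡ ℚ.- fromℤ a
fromℤ-homo‿- (+ zero)   = refl
fromℤ-homo‿- +[1+ n ]  = refl
fromℤ-homo‿- -[1+ n ]  = refl

fromℤ-homo-sub : ∀ a b → fromℤ (a - b) ≡ fromℤ a ℚ.- fromℤ b
fromℤ-homo-sub a b = trans (fromℤ-homo-+ a (- b)) (cong (fromℤ a ℚ.+_) (fromℤ-homo‿- b))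

negOnePow≡fromℤ : ∀ x → negOnePow x ≡ fromℤ (-1ℤ ^ x)
negOnePow≡fromℤ zero    = /1≡fromℤ 1ℤ
negOnePow≡fromℤ (suc x) = begin
  ℚ.- negOnePow x             ≡⟨ cong ℚ.-_ (negOnePow≡fromℤ x) ⟩
  ℚ.- fromℤ (-1ℤ ^ x)         ≡⟨ sym (fromℤ-homo‿- (-1ℤ ^ x)) ⟩
  fromℤ (- (-1ℤ ^ x))         ≡⟨ cong fromℤ (sym (ℤ.-1*i≡-i (-1ℤ ^ x))) ⟩
  fromℤ (-1ℤ ^ suc x)         ∎

sumBelow-alternating : ∀ (f : ℕ → ℤ) m →
  sumBelow m (λ x → negOnePow x ℚ.* (f x ℚ./ 1)) ≡ fromℤ (altSum f m)
sumBelow-alternating f zero    = /1≡fromℤ (+ 0)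
sumBelow-alternating f (suc m) = begin
  sumBelow m g ℚ.+ negOnePow m ℚ.* (f m ℚ./ 1)
    ≡⟨ cong₂ (λ u v → u ℚ.+ v ℚ.* (f m ℚ./ 1)) (sumBelow-alternating f m) (negOnePow≡fromℤ m) ⟩
  fromℤ (altSum f m) ℚ.+ fromℤ (-1ℤ ^ m) ℚ.* (f m ℚ./ 1)
    ≡⟨ cong (λ u → fromℤ (altSum f m) ℚ.+ fromℤ (-1ℤ ^ m) ℚ.* u) (/1≡fromℤ (f m)) ⟩
  fromℤ (altSum f m) ℚ.+ fromℤ (-1ℤ ^ m) ℚ.* fromℤ (f m)
    ≡⟨ cong (fromℤ (altSum f m) ℚ.+_) (sym (fromℤ-homo-* (-1ℤ ^ m) (f m))) ⟩
  fromℤ (altSum f m) ℚ.+ fromℤ (-1ℤ ^ m * f m)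
    ≡⟨ sym (fromℤ-homo-+ (altSum f m) (-1ℤ ^ m * f m)) ⟩
  fromℤ (altSum f (suc m)) ∎
  where
  g = λ x → negOnePow x ℚ.* (f x ℚ./ 1)

two : ℚ
two = 1ℚ ℚ.+ 1ℚ

fromℤ-2^suc : ∀ n → fromℤ (+ (2 ℕ.^ suc n)) ≡ two ℚ.* fromℤ (+ (2 ℕ.^ n))
fromℤ-2^suc n = trans (cong fromℤ (ℤ.pos-* 2 (2 ℕ.^ n))) (fromℤ-homo-* (+ 2) (+ (2 ℕ.^ n)))

invPow2-inverse : ∀ n → invPow2 n ℚ.* fromℤ (+ (2 ℕ.^ n)) ≡ 1ℚ
invPow2-inverse zero    = refl
invPow2-inverse (suc n) = begin
  (half ℚ.* invPow2 n) ℚ.* fromℤ (+ (2 ℕ.^ suc n))  ≡⟨ cong ((half ℚ.* invPow2 n) ℚ.*_) (fromℤ-2^suc n) ⟩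
  (half ℚ.* invPow2 n) ℚ.* (two ℚ.* t)             ≡⟨ regroup half (invPow2 n) two t ⟩
  (half ℚ.* two) ℚ.* (invPow2 n ℚ.* t)             ≡⟨ cong ((half ℚ.* two) ℚ.*_) (invPow2-inverse n) ⟩
  1ℚ                                               ∎
  where
  half = + 1 ℚ./ 2
  t = fromℤ (+ (2 ℕ.^ n))
  regroup : ∀ a b c d → (a ℚ.* b) ℚ.* (c ℚ.* d) ≡ (a ℚ.* c) ℚ.* (b ℚ.* d)
  regroup = +-*-Solver.solve 4 (λ a b c d → (a :* b) :* (c :* d) := (a :* c) :* (b :* d)) refl
    where open +-*-Solver

rhs≡eulerFalling : ∀ n → rhs (suc n) ≡ fromℤ (eulerFalling (suc n) (+ 0)) ℚ.* invPow2 (suc n)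
rhs≡eulerFalling n = begin
  negOnePow (suc (suc n)) ℚ.* ((+ (suc n !) ℚ./ 1) ℚ.* I)
    ≡⟨ cong₂ (λ u v → u ℚ.* (v ℚ.* I)) (negOnePow≡fromℤ (suc (suc n))) (/1≡fromℤ (+ (suc n !))) ⟩
  fromℤ (-1ℤ ^ suc (suc n)) ℚ.* (fromℤ (+ (suc n !)) ℚ.* I)
    ≡⟨ sym (ℚ.*-assoc (fromℤ (-1ℤ ^ suc (suc n))) (fromℤ (+ (suc n !))) I) ⟩
  fromℤ (-1ℤ ^ suc (suc n)) ℚ.* fromℤ (+ (suc n !)) ℚ.* I
    ≡⟨ cong (ℚ._* I) (sym (fromℤ-homo-* (-1ℤ ^ suc (suc n)) (+ (suc n !)))) ⟩
  fromℤ (-1ℤ ^ suc (suc n) * + (suc n !)) ℚ.* I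
    ≡⟨ cong (λ s → fromℤ (s * + (suc n !)) ℚ.* I) (-1^-suc-suc n) ⟩
  fromℤ (-1ℤ ^ n * + (suc n !)) ℚ.* I
    ≡⟨ cong (λ e → fromℤ e ℚ.* I) (sym (eulerFalling-zero n)) ⟩
  fromℤ (eulerFalling (suc n) (+ 0)) ℚ.* I ∎
  where
  I = invPow2 (suc n)

scaledDeviation : ∀ s g h i t → (two ℚ.* t) ℚ.* s ≡ g ℚ.+ h → i ℚ.* t ≡ 1ℚ →
                  (s ℚ.- g ℚ.* i) ℚ.* (two ℚ.* t) ≡ h ℚ.- g
scaledDeviation s g h i t 2ts≡g+h it≡1 = begin
  (s ℚ.- g ℚ.* i) ℚ.* (two ℚ.* t)
    ≡⟨ expand s g i t ⟩
  (two ℚ.* t) ℚ.* s ℚ.- two ℚ.* g ℚ.* (i ℚ.* t)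
    ≡⟨ cong₂ (λ u v → u ℚ.- two ℚ.* g ℚ.* v) 2ts≡g+h it≡1 ⟩
  (g ℚ.+ h) ℚ.- two ℚ.* g ℚ.* 1ℚ
    ≡⟨ collapse g h ⟩
  h ℚ.- g ∎
  where
  open +-*-Solver
  expand : ∀ s g i t →
           (s ℚ.- g ℚ.* i) ℚ.* (two ℚ.* t) ≡ (two ℚ.* t) ℚ.* s ℚ.- two ℚ.* g ℚ.* (i ℚ.* t)
  expand = solve 4 (λ s g i t → (s :- g :* i) :* (con two :* t)
                              := (con two :* t) :* s :- con two :* g :* (i :* t)) refl
  collapse : ∀ g h → (g ℚ.+ h) ℚ.- two ℚ.* g ℚ.* 1ℚ ≡ h ℚ.- g
  collapse = solve 2 (λ g h → (g :+ h) :- (con 1ℚ :+ con 1ℚ) :* g :* con 1ℚ := h :- g) refl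

fermionicSum-error : ∀ n m → ¬ 2 ℕ.∣ m →
  (sumBelow m (λ x → negOnePow x ℚ.* integrand (suc n) x) ℚ.- rhs (suc n)) ℚ.* fromℤ (+ (2 ℕ.^ suc (suc n)))
    ≡ fromℤ (eulerFalling (suc n) (+ m) - eulerFalling (suc n) (+ 0))
fermionicSum-error n m 2∤m = begin
  (sumBelow m (λ x → negOnePow x ℚ.* integrand (suc n) x) ℚ.- rhs (suc n)) ℚ.* c
    ≡⟨ cong₂ (λ u v → (u ℚ.- v) ℚ.* c) (sumBelow-alternating f m) (rhs≡eulerFalling n) ⟩
  (fromℤ (altSum f m) ℚ.- g ℚ.* I) ℚ.* c
    ≡⟨ cong ((fromℤ (altSum f m) ℚ.- g ℚ.* I) ℚ.*_) (fromℤ-2^suc (suc n)) ⟩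
  (fromℤ (altSum f m) ℚ.- g ℚ.* I) ℚ.* (two ℚ.* t)
    ≡⟨ scaledDeviation (fromℤ (altSum f m)) g h I t telescoped (invPow2-inverse (suc n)) ⟩
  h ℚ.- g
    ≡⟨ sym (fromℤ-homo-sub (eulerFalling (suc n) (+ m)) (eulerFalling (suc n) (+ 0))) ⟩
  fromℤ (eulerFalling (suc n) (+ m) - eulerFalling (suc n) (+ 0)) ∎
  where
  c = fromℤ (+ (2 ℕ.^ suc (suc n)))
  f = λ x → fallFact (+ suc x) (suc n)
  g = fromℤ (eulerFalling (suc n) (+ 0))
  h = fromℤ (eulerFalling (suc n) (+ m))
  I = invPow2 (suc n)
  t = fromℤ (+ (2 ℕ.^ suc n))
  telescoped : (two ℚ.* t) ℚ.* fromℤ (altSum f m) ≡ g ℚ.+ h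
  telescoped = begin
    (two ℚ.* t) ℚ.* fromℤ (altSum f m)
      ≡⟨ cong (ℚ._* fromℤ (altSum f m)) (sym (fromℤ-2^suc (suc n))) ⟩
    c ℚ.* fromℤ (altSum f m)
      ≡⟨ sym (fromℤ-homo-* (+ (2 ℕ.^ suc (suc n))) (altSum f m)) ⟩
    fromℤ (+ (2 ℕ.^ suc (suc n)) * altSum f m)
      ≡⟨ cong fromℤ (altSum-eulerFalling (suc n) m 2∤m) ⟩
    fromℤ (eulerFalling (suc n) (+ 0) + eulerFalling (suc n) (+ m))
      ≡⟨ fromℤ-homo-+ (eulerFalling (suc n) (+ 0)) (eulerFalling (suc n) (+ m)) ⟩
    g ℚ.+ h ∎

cross-multiply : ∀ q c X → q ℚ.* fromℤ c ≡ fromℤ X → ↥ q * c ≡ X * ↧ q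
cross-multiply q c X eq = begin
  ↥ q * c                  ≡⟨ sym (ℚ.↥-* q (fromℤ c)) ⟩
  ↥ (q ℚ.* fromℤ c) * nf   ≡⟨ cong (λ u → ↥ u * nf) eq ⟩
  X * nf                   ≡⟨ cong (X *_) nf≡↧q ⟩
  X * ↧ q                  ∎
  where
  -- the normalising gcd of the product; the denominator 1 of fromℤ X forces it to be ↧ q
  nf = gcd (↥ q * c) (↧ q * + 1)
  nf≡↧q : nf ≡ ↧ q
  nf≡↧q = begin
    nf                       ≡⟨ sym (ℤ.*-identityˡ nf) ⟩
    ↧ (fromℤ X) * nf         ≡⟨ cong (λ u → ↧ u * nf) (sym eq) ⟩
    ↧ (q ℚ.* fromℤ c) * nf   ≡⟨ ℚ.↧-* q (fromℤ c) ⟩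
    ↧ q * + 1                ≡⟨ ℤ.*-identityʳ (↧ q) ⟩
    ↧ q                      ∎

∣↥-cancel : ∀ {m} q c X → q ℚ.* fromℤ c ≡ fromℤ X →
            Coprime m ∣ c ∣ → m ℕ.∣ ∣ X ∣ → m ℕ.∣ ∣ ↥ q ∣
∣↥-cancel {m} q c X eq m⊥c m∣X =
  coprime-divisor m⊥c (subst (m ℕ.∣_) swap (ℕ.∣m⇒∣m*n (↧ₙ q) m∣X))
  where
  swap : ∣ X ∣ ℕ.* ↧ₙ q ≡ ∣ c ∣ ℕ.* ∣ ↥ q ∣
  swap = begin
    ∣ X ∣ ℕ.* ↧ₙ q          ≡⟨ sym (ℤ.abs-* X (↧ q)) ⟩
    ∣ X * ↧ q ∣             ≡⟨ cong ∣_∣ (sym (cross-multiply q c X eq)) ⟩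
    ∣ ↥ q * c ∣             ≡⟨ ℤ.abs-* (↥ q) c ⟩
    ∣ ↥ q ∣ ℕ.* ∣ c ∣       ≡⟨ ℕ.*-comm ∣ ↥ q ∣ ∣ c ∣ ⟩
    ∣ c ∣ ℕ.* ∣ ↥ q ∣       ∎

↥⊥↧ₙ : ∀ q → Coprime ∣ ↥ q ∣ (↧ₙ q)
↥⊥↧ₙ (mkℚ _ _ coprime) = Coprimality.recompute coprime

^∣↥⇒ValAtLeast : ∀ {p k N} q → p ≢ 1 → k < N → p ℕ.^ N ℕ.∣ ∣ ↥ q ∣ → ValAtLeast p k q
^∣↥⇒ValAtLeast {p} {k} {suc N} q p≢1 (s≤s k≤N) pᴺ∣↥q =
  ℕ.∣-trans (^-monoʳ-∣ p (ℕ.m≤n⇒m≤1+n k≤N)) pᴺ∣↥q ,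
  λ p∣↧q → p≢1 (↥⊥↧ₙ q (ℕ.∣-trans (ℕ.m∣m*n (p ℕ.^ N)) pᴺ∣↥q , p∣↧q))

mainTheorem17 : (p : ℕ) → Prime p → p ≢ 2 →
                (n : ℕ) → 1 ≤ n →
                FermionicIntegral p (integrand n) (rhs n)
mainTheorem17 p p-prime p≢2 (suc n) _ k = suc k , λ N k<N →
  ^∣↥⇒ValAtLeast (error N) (ℕ.nonTrivial⇒≢1 {p}) k<N (pᴺ∣error N)
  where
  instance
    _ = prime⇒nonTrivial p-prime
  p⊥2 : Coprime p 2
  p⊥2 = prime⇒coprime p-prime (ℕ.≤∧≢⇒< (ℕ.nonTrivial⇒n>1 p) (p≢2 ∘ sym))
  pᴺ-odd : ∀ N → ¬ 2 ℕ.∣ p ℕ.^ N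
  pᴺ-odd N 2∣pᴺ with coprime-^ʳ (Coprimality.sym p⊥2) N (ℕ.∣-refl , 2∣pᴺ)
  ... | ()
  error : ℕ → ℚ
  error N = fermionicSum p (integrand (suc n)) N ℚ.- rhs (suc n)
  pᴺ∣error : ∀ N → p ℕ.^ N ℕ.∣ ∣ ↥ error N ∣
  pᴺ∣error N = ∣↥-cancel (error N) (+ (2 ℕ.^ suc (suc n))) _
    (fermionicSum-error n (p ℕ.^ N) (pᴺ-odd N))
    (coprime-^ p⊥2 N (suc (suc n)))
    (eulerFalling-congruence (suc n) (p ℕ.^ N))
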